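{- There exists an infinite family of finite simple graphs $G$, where $n$ denotes the order of $G$, such that each $G$ in the family satisfies \[ \delta(G) \geq \frac{n}{2} + \frac{\ln n}{2\ln(27/4)} \] and $G$ does not have an orientation of diameter $2$.
   Context: $\delta(G)$ denotes the minimum degree of $G$ and $\ln$ is the natural logarithm. An orientation of $G$ is a digraph obtained by assigning a direction to each edge of $G$. An orientation $D$ of $G$ has diameter $2$ if for every ordered pair of distinct vertices $u,v$ there is a directed path of length at most $2$ from $u$ to $v$ in $D$, with $2$ being the maximum over all such pairs of the length of a shortest directed path. -}

module Defs where

open import Data.Nat using (ℕ; _+_; _*_; _∸_; _^_; _≤_)
open import Data.Fin using (Fin)
open import Data.Bool using (Bool; true; false; T)
open import Data.List using (List; length; filter; allFin)
open import Data.Product using (Σ; ∃; _×_; _,_)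
open import Data.Sum using (_⊎_)
open import Relation.Nullary using (¬_)
open import Relation.Binary.PropositionalEquality using (_≡_)
open import Data.Bool.Properties using (T?)

record SimpleGraph (n : ℕ) : Set where
  field
    adj     : Fin n → Fin n → Bool
    adj-sym : ∀ u v → adj u v ≡ adj v u
    adj-irr : ∀ v → adj v v ≡ false

open SimpleGraph public

Adj : ∀ {n} → SimpleGraph n → Fin n → Fin n → Set
Adj G u v = T (adj G u v)

degree : ∀ {n} → SimpleGraph n → Fin n → ℕ
degree {n} G v = length (filter (λ u → T? (adj G v u)) (allFin n))

MinDegreeAtLeast : ∀ {n} → SimpleGraph n → ℕ → Set
MinDegreeAtLeast {n} G d = ∀ (v : Fin n) → d ≤ degree G v

record Orientation {n : ℕ} (G : SimpleGraph n) : Set₁ where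
  field
    Arc       : Fin n → Fin n → Set
    arc-edge  : ∀ u v → Arc u v → Adj G u v
    edge-arc  : ∀ u v → Adj G u v → Arc u v ⊎ Arc v u
    arc-asym  : ∀ u v → Arc u v → ¬ Arc v u

open Orientation public

Within2 : ∀ {n} {G : SimpleGraph n} → Orientation G → Fin n → Fin n → Set
Within2 {n} D u v = Arc D u v ⊎ Σ (Fin n) (λ w → Arc D u w × Arc D w v)

HasDiameter2 : ∀ {n} {G : SimpleGraph n} → Orientation G → Set
HasDiameter2 {n} D =
  (∀ (u v : Fin n) → ¬ u ≡ v → Within2 D u v)
  × Σ (Fin n) (λ u → Σ (Fin n) (λ v → ¬ u ≡ v × ¬ Arc D u v))

HasOrientationOfDiameter2 : ∀ {n} → SimpleGraph n → Set₁
HasOrientationOfDiameter2 G = Σ (Orientation G) HasDiameter2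

-- The real inequality  δ ≥ n/2 + ln n / (2 ln(27/4))  (for n ≥ 1) is
-- equivalent, by monotonicity of ln and ln(27/4) > 0, to
--   2δ ≥ n  and  (27/4)^(2δ - n) ≥ n,
-- i.e.  2δ ≥ n  and  n * 4^(2δ - n) ≤ 27^(2δ - n).
BoundHolds : ℕ → ℕ → Set
BoundHolds n d = (n ≤ 2 * d) × (n * 4 ^ (2 * d ∸ n) ≤ 27 ^ (2 * d ∸ n))

{-# OPTIONS --safe #-}
-- Take cliques P, S, M with |S| = 2t + 3 and |P| = 2^|S| + 1, join P completely to S, and let
-- every 2-colouring of S be represented by a vertex of M joined to its majority colour class.
-- Given an orientation, colour w ∈ S by whether the edge vw leaves a fixed v ∈ P. Some u ∈ M sees
-- one colour only; but v and u are non-adjacent and all their common neighbours lie in N(u) ∩ S,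
-- so diameter 2 would need paths v → w → u and u → w′ → v with w, w′ of different colours.
-- Majority classes have at least t + 2 vertices, so with |M| = 2^|S| + t + 2 every degree is at
-- least δ = 2^|S| + |S|, and 2δ − n = t while n ≈ 16 · 4^t; hence n · 4^t ≤ 27^t once t ≥ 6.
module Submission where

open import Defs
open import Data.Nat using (ℕ; zero; suc; _+_; _*_; _∸_; _^_; _≤_; _<_; _≤ᵇ_; s≤s)
open import Data.Nat.Properties
  using ( +-assoc; +-suc; +-identityʳ; *-assoc; *-distribˡ-+; ≤-trans; ≤-<-trans; <⇒≤; ≰⇒>
        ; n≤1+n; m≤m+n; m≤n+m; m+n∸n≡m; +-monoˡ-<; +-monoʳ-≤; +-monoˡ-≤; *-monoˡ-≤; *-monoʳ-≤
        ; +-cancelˡ-<; *-cancelˡ-<; ≤ᵇ⇒≤; ≤ᵇ-reflects-≤; module ≤-Reasoning)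
open import Data.Nat.Tactic.RingSolver using (solve-∀)
open import Data.Fin using (Fin; zero; suc; _↑ˡ_; _↑ʳ_; splitAt; finToFun; funToFin)
open import Data.Fin.Properties using (_≟_; splitAt-↑ˡ; splitAt-↑ʳ; join-splitAt; 2↔Bool; finToFun-funToFin)
open import Data.Bool using (Bool; true; false; T; not; if_then_else_)
open import Data.Bool.Properties using (T?)
open import Data.List using (length; filter; tabulate)
open import Data.Product using (Σ; ∃-syntax; _×_; _,_)
open import Data.Sum using (inj₁; inj₂; [_,_]′)
open import Data.Empty using (⊥-elim)
open import Function using (_∘_; id; const; Inverse)
open import Relation.Nullary using (¬_; does; ofʸ; ofⁿ)
open import Relation.Unary using (Pred)
open import Relation.Binary.PropositionalEquality

indicator : Bool → ℕ
indicator b = if b then 1 else 0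

count : ∀ {n} → (Fin n → Bool) → ℕ
count {zero}  f = 0
count {suc n} f = indicator (f zero) + count (f ∘ suc)

count-tabulate : ∀ {A : Set} {n} (h : Fin n → A) (f : A → Bool) →
                 length (filter (T? ∘ f) (tabulate h)) ≡ count (f ∘ h)
count-tabulate {n = zero}  h f = refl
count-tabulate {n = suc n} h f with f (h zero)
... | true  = cong suc (count-tabulate (h ∘ suc) f)
... | false = count-tabulate (h ∘ suc) f

degree≡count : ∀ {n} (G : SimpleGraph n) v → degree G v ≡ count (adj G v)
degree≡count G v = count-tabulate (λ u → u) (adj G v)

count-cong : ∀ {n} {f g : Fin n → Bool} → (∀ x → f x ≡ g x) → count f ≡ count g
count-cong {zero}  f≗g = refl
count-cong {suc n} f≗g = cong₂ _+_ (cong indicator (f≗g zero)) (count-cong (f≗g ∘ suc))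

count-+ : ∀ m {n} (f : Fin (m + n) → Bool) → count f ≡ count (f ∘ (_↑ˡ n)) + count (f ∘ (m ↑ʳ_))
count-+ zero    f = refl
count-+ (suc m) f = trans (cong (indicator (f zero) +_) (count-+ m (f ∘ suc)))
                          (sym (+-assoc (indicator (f zero)) _ _))

count-true : ∀ n → count {n} (const true) ≡ n
count-true zero    = refl
count-true (suc n) = cong suc (count-true n)

count-complement : ∀ {n} (f : Fin n → Bool) → count f + count (not ∘ f) ≡ n
count-complement {zero}  f = refl
count-complement {suc n} f with f zero
... | true  = cong suc (count-complement (f ∘ suc))
... | false = trans (+-suc _ _) (cong suc (count-complement (f ∘ suc)))

distinct : ∀ {n} → Fin n → Fin n → Bool
distinct a b = not (does (a ≟ b))

distinct-sym : ∀ {n} (a b : Fin n) → distinct a b ≡ distinct b a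
distinct-sym zero    zero    = refl
distinct-sym zero    (suc b) = refl
distinct-sym (suc a) zero    = refl
distinct-sym (suc a) (suc b) = distinct-sym a b

distinct-irrefl : ∀ {n} (a : Fin n) → distinct a a ≡ false
distinct-irrefl zero    = refl
distinct-irrefl (suc a) = distinct-irrefl a

count-distinct : ∀ {n} (a : Fin (suc n)) → count (distinct a) ≡ n
count-distinct {n}     zero    = count-true n
count-distinct {suc n} (suc a) = cong suc (count-distinct a)

Monochromatic : ∀ {a ℓ} {A : Set a} → (A → Bool) → Pred A ℓ → Set _
Monochromatic c P = ∀ {i j} → P i → P j → c i ≡ c j

majority : ∀ {n} → (Fin n → Bool) → Bool
majority {n} c = n ≤ᵇ 2 * count c

colourClass : ∀ {n} → (Fin n → Bool) → Bool → Fin n → Bool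
colourClass c b i = if b then c i else not (c i)

T-colourClass : ∀ {n} (c : Fin n → Bool) b i → T (colourClass c b i) → c i ≡ b
T-colourClass c b i with b | c i
... | true  | true  = λ _ → refl
... | false | false = λ _ → refl
... | true  | false = λ ()
... | false | true  = λ ()

colourClass-monochromatic : ∀ {n} (c : Fin n → Bool) b → Monochromatic c (T ∘ colourClass c b)
colourClass-monochromatic c b {i} {j} i∈ j∈ = trans (T-colourClass c b i i∈) (sym (T-colourClass c b j j∈))

majority-class-large : ∀ {n} (c : Fin n → Bool) → n ≤ 2 * count (colourClass c (majority c))
majority-class-large {n} c with n ≤ᵇ 2 * count c | ≤ᵇ-reflects-≤ n (2 * count c)
... | true  | ofʸ n≤2c = n≤2c
... | false | ofⁿ n≰2c = <⇒≤ (+-cancelˡ-< n n (2 * count (not ∘ c)) (begin-strict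
  n + n                                  ≡⟨ cong (n +_) (sym (+-identityʳ n)) ⟩
  2 * n                                  ≡⟨ cong (2 *_) (sym (count-complement c)) ⟩
  2 * (count c + count (not ∘ c))        ≡⟨ *-distribˡ-+ 2 (count c) _ ⟩
  2 * count c + 2 * count (not ∘ c)      <⟨ +-monoˡ-< _ (≰⇒> n≰2c) ⟩
  n + 2 * count (not ∘ c)                ∎))
  where open ≤-Reasoning

colouring : ∀ {s} → Fin (2 ^ s) → Fin s → Bool
colouring k = Inverse.to 2↔Bool ∘ finToFun k

code : ∀ {s} → (Fin s → Bool) → Fin (2 ^ s)
code c = funToFin (Inverse.from 2↔Bool ∘ c)

colouring-code : ∀ {s} (c : Fin s → Bool) i → colouring (code c) i ≡ c i
colouring-code c i = trans (cong (Inverse.to 2↔Bool) (finToFun-funToFin _ i))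
                           (Inverse.strictlyInverseˡ 2↔Bool (c i))

module _ {n} (G : SimpleGraph n) where

  Adj-sym : ∀ {u v} → Adj G u v → Adj G v u
  Adj-sym {u} {v} = subst T (adj-sym G u v)

  CommonNeighbour : Fin n → Fin n → Pred (Fin n) _
  CommonNeighbour u v w = Adj G u w × Adj G v w

  outward : Orientation G → Fin n → Fin n → Bool
  outward D v w with adj G v w | edge-arc D v w
  ... | true  | arcs = [ const true , const false ]′ (arcs _)
  ... | false | _    = false

  outward-out : ∀ (D : Orientation G) {v w} → Arc D v w → outward D v w ≡ true
  outward-out D {v} {w} vw with adj G v w | edge-arc D v w | arc-edge D v w vw
  ... | false | _    | ()
  ... | true  | arcs | _ with arcs _
  ...   | inj₁ _  = refl
  ...   | inj₂ wv = ⊥-elim (arc-asym D v w vw wv)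

  outward-in : ∀ (D : Orientation G) {v w} → Arc D w v → outward D v w ≡ false
  outward-in D {v} {w} wv with adj G v w | edge-arc D v w
  ... | false | _    = refl
  ... | true  | arcs with arcs _
  ...   | inj₁ vw = ⊥-elim (arc-asym D v w vw wv)
  ...   | inj₂ _  = refl

  monochromatic⇒¬HasOrientationOfDiameter2 :
    (v : Fin n) →
    (∀ (c : Fin n → Bool) → ∃[ u ] (¬ u ≡ v × ¬ Adj G v u × Monochromatic c (CommonNeighbour v u))) →
    ¬ HasOrientationOfDiameter2 G
  monochromatic⇒¬HasOrientationOfDiameter2 v hyp (D , within2 , _)
    with hyp (outward D v)
  ... | u , u≢v , ¬v~u , mono with within2 v u (≢-sym u≢v) | within2 u v u≢v
  ... | inj₁ vu | _ = ¬v~u (arc-edge D v u vu)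
  ... | inj₂ _ | inj₁ uv = ¬v~u (Adj-sym (arc-edge D u v uv))
  ... | inj₂ (w , vw , wu) | inj₂ (w′ , uw′ , w′v) =
    true≢false (trans (sym (outward-out D vw)) (trans
      (mono (arc-edge D v w vw , Adj-sym (arc-edge D w u wu))
            (Adj-sym (arc-edge D w′ v w′v) , arc-edge D u w′ uw′))
      (outward-in D w′v)))
    where true≢false : ¬ true ≡ false
          true≢false ()

data Block (p s m : ℕ) : Set where
  inP : Fin p → Block p s m
  inS : Fin s → Block p s m
  inM : Fin m → Block p s m

module BlockGraph (p s m : ℕ) (g : Fin m → Fin s → Bool) where

  block : Fin (p + (s + m)) → Block p s m
  block x = [ inP , [ inS , inM ]′ ∘ splitAt s ]′ (splitAt p x)

  vertex : Block p s m → Fin (p + (s + m))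
  vertex (inP a) = a ↑ˡ (s + m)
  vertex (inS i) = p ↑ʳ (i ↑ˡ m)
  vertex (inM e) = p ↑ʳ (s ↑ʳ e)

  block-vertex : ∀ b → block (vertex b) ≡ b
  block-vertex (inP a) rewrite splitAt-↑ˡ p a (s + m) = refl
  block-vertex (inS i) rewrite splitAt-↑ʳ p (s + m) (i ↑ˡ m) | splitAt-↑ˡ s i m = refl
  block-vertex (inM e) rewrite splitAt-↑ʳ p (s + m) (s ↑ʳ e) | splitAt-↑ʳ s m e = refl

  vertex-block : ∀ x → vertex (block x) ≡ x
  vertex-block x with splitAt p x | join-splitAt p (s + m) x
  ... | inj₁ a | eq = eq
  ... | inj₂ y | eq with splitAt s y | join-splitAt s m y
  ...   | inj₁ i | eq′ = trans (cong (p ↑ʳ_) eq′) eq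
  ...   | inj₂ e | eq′ = trans (cong (p ↑ʳ_) eq′) eq

  blockAdj : Block p s m → Block p s m → Bool
  blockAdj (inP a) (inP b) = distinct a b
  blockAdj (inP _) (inS _) = true
  blockAdj (inP _) (inM _) = false
  blockAdj (inS _) (inP _) = true
  blockAdj (inS i) (inS j) = distinct i j
  blockAdj (inS i) (inM e) = g e i
  blockAdj (inM _) (inP _) = false
  blockAdj (inM e) (inS i) = g e i
  blockAdj (inM e) (inM f) = distinct e f

  blockAdj-sym : ∀ b b′ → blockAdj b b′ ≡ blockAdj b′ b
  blockAdj-sym (inP a) (inP b) = distinct-sym a b
  blockAdj-sym (inP _) (inS _) = refl
  blockAdj-sym (inP _) (inM _) = refl
  blockAdj-sym (inS _) (inP _) = refl
  blockAdj-sym (inS i) (inS j) = distinct-sym i j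
  blockAdj-sym (inS _) (inM _) = refl
  blockAdj-sym (inM _) (inP _) = refl
  blockAdj-sym (inM _) (inS _) = refl
  blockAdj-sym (inM e) (inM f) = distinct-sym e f

  blockAdj-irrefl : ∀ b → blockAdj b b ≡ false
  blockAdj-irrefl (inP a) = distinct-irrefl a
  blockAdj-irrefl (inS i) = distinct-irrefl i
  blockAdj-irrefl (inM e) = distinct-irrefl e

  graph : SimpleGraph (p + (s + m))
  graph = record
    { adj     = λ u v → blockAdj (block u) (block v)
    ; adj-sym = λ u v → blockAdj-sym (block u) (block v)
    ; adj-irr = λ v → blockAdj-irrefl (block v)
    }

  Adj-vertex : ∀ b x → Adj graph (vertex b) x ≡ T (blockAdj b (block x))
  Adj-vertex b x = cong (λ b′ → T (blockAdj b′ (block x))) (block-vertex b)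

  blockDegree : Block p s m → ℕ
  blockDegree b = count (blockAdj b ∘ inP) + (count (blockAdj b ∘ inS) + count (blockAdj b ∘ inM))

  count-block : ∀ (f : Block p s m → Bool) →
                count (f ∘ block) ≡ count (f ∘ inP) + (count (f ∘ inS) + count (f ∘ inM))
  count-block f = begin
    count (f ∘ block)
      ≡⟨ count-+ p (f ∘ block) ⟩
    count (f ∘ block ∘ vertex ∘ inP) + count (f ∘ block ∘ (p ↑ʳ_))
      ≡⟨ cong (count (f ∘ block ∘ vertex ∘ inP) +_) (count-+ s (f ∘ block ∘ (p ↑ʳ_))) ⟩
    count (f ∘ block ∘ vertex ∘ inP) + (count (f ∘ block ∘ vertex ∘ inS) + count (f ∘ block ∘ vertex ∘ inM))
      ≡⟨ cong₂ _+_ (count-cong (cong f ∘ block-vertex ∘ inP))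
                   (cong₂ _+_ (count-cong (cong f ∘ block-vertex ∘ inS))
                              (count-cong (cong f ∘ block-vertex ∘ inM))) ⟩
    count (f ∘ inP) + (count (f ∘ inS) + count (f ∘ inM))
      ∎
    where open ≡-Reasoning

  degree-block : ∀ x → degree graph x ≡ blockDegree (block x)
  degree-block x = trans (degree≡count graph x) (count-block (blockAdj (block x)))

  minDegree : ∀ d → (∀ b → d ≤ blockDegree b) → MinDegreeAtLeast graph d
  minDegree d d≤ x = subst (d ≤_) (sym (degree-block x)) (d≤ (block x))

  commonNeighbour⇒inS : ∀ {a e} w → CommonNeighbour graph (vertex (inP a)) (vertex (inM e)) w →
                      ∃[ i ] (w ≡ vertex (inS i) × T (g e i))
  commonNeighbour⇒inS {a} {e} w (a~w , e~w)
    with block w | vertex-block w | subst id (Adj-vertex (inP a) w) a~w | subst id (Adj-vertex (inM e) w) e~w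
  ... | inS i | w≡i | _ | e~i = i , sym w≡i , e~i

  ¬HasOrientationOfDiameter2 : Fin p → (∀ (c : Fin s → Bool) → ∃[ e ] Monochromatic c (T ∘ g e)) →
                               ¬ HasOrientationOfDiameter2 graph
  ¬HasOrientationOfDiameter2 a hit = monochromatic⇒¬HasOrientationOfDiameter2 graph (vertex (inP a)) spoiler
    where
    spoiler : ∀ (c : Fin (p + (s + m)) → Bool) →
              ∃[ u ] (¬ u ≡ vertex (inP a) × ¬ Adj graph (vertex (inP a)) u ×
                      Monochromatic c (CommonNeighbour graph (vertex (inP a)) u))
    spoiler c with hit (c ∘ vertex ∘ inS)
    ... | e , mono = vertex (inM e) , M≢P , ¬P~M , monochromatic
      where
      M≢P : ¬ vertex (inM e) ≡ vertex (inP a)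
      M≢P eq with trans (sym (block-vertex (inM e))) (trans (cong block eq) (block-vertex (inP a)))
      ... | ()
      ¬P~M : ¬ Adj graph (vertex (inP a)) (vertex (inM e))
      ¬P~M = subst (T ∘ blockAdj (inP a)) (block-vertex (inM e)) ∘ subst id (Adj-vertex (inP a) (vertex (inM e)))
      monochromatic : Monochromatic c (CommonNeighbour graph (vertex (inP a)) (vertex (inM e)))
      monochromatic {w} {w′} w∈ w′∈ with commonNeighbour⇒inS w w∈ | commonNeighbour⇒inS w′ w′∈
      ... | i , refl , i∈ | j , refl , j∈ = mono i∈ j∈

module Family (t : ℕ) where

  s p m : ℕ
  s = 3 + 2 * t
  p = 1 + 2 ^ s
  m = (2 + t) + 2 ^ s

  -- The first 2 + t vertices of M are padding that lifts the degrees inside M to δ.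
  colouringOf : Fin m → Fin s → Bool
  colouringOf e = [ const (const true) , colouring ]′ (splitAt (2 + t) e)

  neighbourhood : Fin m → Fin s → Bool
  neighbourhood e = colourClass (colouringOf e) (majority (colouringOf e))

  open BlockGraph p s m neighbourhood public

  order : ℕ
  order = p + (s + m)

  δ : ℕ
  δ = 2 ^ s + s

  hits-every-colouring : ∀ (c : Fin s → Bool) → ∃[ e ] Monochromatic c (T ∘ neighbourhood e)
  hits-every-colouring c = e , λ {i} {j} i∈ j∈ →
    trans (sym (colouringOf-e i))
          (trans (colourClass-monochromatic (colouringOf e) (majority (colouringOf e)) i∈ j∈) (colouringOf-e j))
    where
    e : Fin m
    e = (2 + t) ↑ʳ code c
    colouringOf-e : ∀ i → colouringOf e i ≡ c i
    colouringOf-e i rewrite splitAt-↑ʳ (2 + t) (2 ^ s) (code c) = colouring-code c i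

  open ≤-Reasoning

  majority-class≥2+t : ∀ (c : Fin s → Bool) → 2 + t ≤ count (colourClass c (majority c))
  majority-class≥2+t c = *-cancelˡ-< 2 (1 + t) _
    (subst (_≤ 2 * count (colourClass c (majority c))) (cong suc (sym (*-distribˡ-+ 2 1 t)))
           (majority-class-large c))

  blockDegree≥δ : ∀ b → δ ≤ blockDegree b
  blockDegree≥δ (inP a) = begin
    2 ^ s + s                                 ≡⟨ cong₂ _+_ (sym (count-distinct a)) (sym (count-true s)) ⟩
    count (distinct a) + count {s} (const true) ≤⟨ +-monoʳ-≤ (count (distinct a)) (m≤m+n _ _) ⟩
    blockDegree (inP a)                       ∎
  blockDegree≥δ (inS i) = begin
    2 ^ s + s                                 ≡⟨ +-suc (2 ^ s) (2 + 2 * t) ⟩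
    p + (2 + 2 * t)                           ≡⟨ cong₂ _+_ (sym (count-true p)) (sym (count-distinct i)) ⟩
    count {p} (const true) + count (distinct i) ≤⟨ +-monoʳ-≤ (count {p} (const true)) (m≤m+n _ _) ⟩
    blockDegree (inS i)                       ∎
  blockDegree≥δ (inM e) = begin
    2 ^ s + s                                 ≡⟨ arith t (2 ^ s) ⟩
    (2 + t) + (1 + t + 2 ^ s)                 ≤⟨ +-monoˡ-≤ (1 + t + 2 ^ s) (majority-class≥2+t (colouringOf e)) ⟩
    count (neighbourhood e) + (1 + t + 2 ^ s) ≡⟨ cong (count (neighbourhood e) +_) (sym (count-distinct e)) ⟩
    count (neighbourhood e) + count (distinct e) ≤⟨ m≤n+m _ (count {p} (const false)) ⟩
    blockDegree (inM e)                       ∎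
    where
    arith : ∀ t q → q + (3 + 2 * t) ≡ (2 + t) + (1 + t + q)
    arith = solve-∀

  2δ≡t+order : 2 * δ ≡ t + order
  2δ≡t+order = arith t (2 ^ s)
    where
    arith : ∀ t q → 2 * (q + (3 + 2 * t)) ≡ t + ((1 + q) + ((3 + 2 * t) + ((2 + t) + q)))
    arith = solve-∀

  boundHolds : order * 4 ^ t ≤ 27 ^ t → BoundHolds order δ
  boundHolds growth = subst (order ≤_) (sym 2δ≡t+order) (m≤n+m order t) ,
                      subst (λ x → order * 4 ^ x ≤ 27 ^ x) (sym 2δ∸order) growth
    where
    2δ∸order : 2 * δ ∸ order ≡ t
    2δ∸order = trans (cong (_∸ order) 2δ≡t+order) (m+n∸n≡m t order)

  t<order : t < order
  t<order = ≤-trans (s≤s (≤-trans (m≤m+n t (2 ^ s)) (n≤1+n _))) (≤-trans (m≤n+m m s) (m≤n+m (s + m) p))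

open Family using (order)

2^s-suc : ∀ t → 2 ^ Family.s (suc t) ≡ 4 * 2 ^ Family.s t
2^s-suc t = trans (cong (2 ^_) (arith t)) (sym (*-assoc 2 2 (2 ^ Family.s t)))
  where
  arith : ∀ t → 3 + 2 * suc t ≡ 2 + (3 + 2 * t)
  arith = solve-∀

order-suc : ∀ t → order (suc t) ≤ 4 * order t
order-suc t = begin
  order (suc t)                                                ≡⟨ cong (λ q → (1 + q) + ((3 + 2 * suc t) + ((2 + suc t) + q))) (2^s-suc t) ⟩
  (1 + 4 * q) + ((3 + 2 * suc t) + ((2 + suc t) + 4 * q))      ≤⟨ m≤m+n _ (9 * t + 15) ⟩
  (1 + 4 * q) + ((3 + 2 * suc t) + ((2 + suc t) + 4 * q)) + (9 * t + 15) ≡⟨ arith t q ⟩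
  4 * order t                                                  ∎
  where
  open ≤-Reasoning
  q : ℕ
  q = 2 ^ Family.s t
  arith : ∀ t q → (1 + 4 * q) + ((3 + 2 * suc t) + ((2 + suc t) + 4 * q)) + (9 * t + 15)
                  ≡ 4 * ((1 + q) + ((3 + 2 * t) + ((2 + t) + q)))
  arith = solve-∀

order-growth : ∀ k → order (k + 6) * 4 ^ (k + 6) ≤ 27 ^ (k + 6)
order-growth zero    = ≤ᵇ⇒≤ _ _ _   -- 65560 · 4^6 ≤ 27^6, by evaluation
order-growth (suc k) = begin
  order (suc t) * (4 * 4 ^ t)   ≤⟨ *-monoˡ-≤ (4 * 4 ^ t) (order-suc t) ⟩
  (4 * order t) * (4 * 4 ^ t)   ≡⟨ arith (order t) (4 ^ t) ⟩
  16 * (order t * 4 ^ t)        ≤⟨ *-monoʳ-≤ 16 (order-growth k) ⟩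
  16 * 27 ^ t                   ≤⟨ *-monoˡ-≤ (27 ^ t) (≤ᵇ⇒≤ 16 27 _) ⟩
  27 * 27 ^ t                   ∎
  where
  open ≤-Reasoning
  t : ℕ
  t = k + 6
  arith : ∀ a b → (4 * a) * (4 * b) ≡ 16 * (a * b)
  arith = solve-∀

theorem2 : (N : ℕ) → Σ ℕ (λ n → N < n × Σ (SimpleGraph n) (λ G → Σ ℕ (λ d → MinDegreeAtLeast G d × BoundHolds n d × ¬ HasOrientationOfDiameter2 G)))
theorem2 N = order t , ≤-<-trans (m≤m+n N 6) t<order , graph , δ , minDegree δ blockDegree≥δ ,
             boundHolds (order-growth N) , ¬HasOrientationOfDiameter2 zero hits-every-colouring
  where
  t : ℕ
  t = N + 6
  open Family t hiding (order)
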